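{- Let $f\ne 0$ be in $K$, and write $f=(r^2+r)g(r^2)$ with $g\in\mathbb{Z}/2[t]$ of degree $4m$ ($m\ge 0$). Then $\mathrm{pr}_1(f)$ is the class in $K1/N1$ of $\big(G^{2m}+\sum_{k<m}\epsilon_kG^{2k}\big)F$ for some $\epsilon_k\in\mathbb{Z}/2$.
   Context: $\mathbb{Z}/2[r]$, $\mathbb{Z}/2[t]$ are polynomial rings over the field with two elements; $F=r(r+1)^3$, $G=r^3(r+1)$. $\mathbb{Z}/2[r]$ is a free $\mathbb{Z}/2[G]$-module with basis $1,r,r^2,r^3$. $U:\mathbb{Z}/2[r]\to\mathbb{Z}/2[r]$ is $U\big(\sum_{i=0}^3 g_i(G)r^i\big)=\sum_{i=0}^3 g_i(F)U(r^i)$ with $U(1)=1$, $U(r)=r$, $U(r^2)=r^2$, $U(r^3)=r^3+r^2+r$. $M(\mathit{odd})=\{(r^2+r)h(r^2): h\in\mathbb{Z}/2[t]\}$ and $K=\{f\in M(\mathit{odd}): U(f)=f\}$. $N2$, $K1$, $K5$, $N1$ are the free $\mathbb{Z}/2[G^2]$-submodules of $\mathbb{Z}/2[r]$ with bases $\{G,F,F^2G\}$, $\{G,F\}$, $\{G,F^2G\}$, $\{G\}$; $N2/N1=K1/N1\oplus K5/N1$, giving a projection $N2/N1\to K1/N1$. One has $K\subseteq N2$, and $\mathrm{pr}_1:K\to K1/N1$ is the composite of the inclusion $K\subseteq N2$, the quotient map $N2\to N2/N1$, and this projection. -}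

module Defs where

open import Data.Bool using (Bool; true; false; _xor_; _∧_)
open import Data.List using (List; []; _∷_; _++_; map; replicate)
open import Data.List.Relation.Unary.All using (All)
open import Data.Nat using (ℕ; zero; suc; _<_)
open import Data.Vec using (Vec; toList)
open import Data.Product using (Σ; ∃; _×_)
open import Relation.Binary.PropositionalEquality using (_≡_)
open import Relation.Nullary using (¬_)

-- Polynomials over ℤ/2 as coefficient lists, lowest degree first.
-- Trailing zero coefficients are allowed; equality is taken up to them (_≈_).
Poly : Set
Poly = List Bool

infixl 6 _⊕_
infixl 7 _⊗_ _·_

_⊕_ : Poly → Poly → Poly
[] ⊕ q = q
(a ∷ p) ⊕ [] = a ∷ p
(a ∷ p) ⊕ (b ∷ q) = (a xor b) ∷ (p ⊕ q)

_·_ : Bool → Poly → Poly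
c · p = map (c ∧_) p

_⊗_ : Poly → Poly → Poly
[] ⊗ q = []
(a ∷ p) ⊗ q = (a · q) ⊕ (false ∷ (p ⊗ q))

_∘ₚ_ : Poly → Poly → Poly
[] ∘ₚ q = []
(a ∷ p) ∘ₚ q = (a ∷ []) ⊕ (q ⊗ (p ∘ₚ q))

coeff : Poly → ℕ → Bool
coeff [] n = false
coeff (a ∷ p) zero = a
coeff (a ∷ p) (suc n) = coeff p n

IsZero : Poly → Set
IsZero p = All (_≡ false) p

infix 4 _≈_
_≈_ : Poly → Poly → Set
p ≈ q = IsZero (p ⊕ q)

HasDegree : Poly → ℕ → Set
HasDegree p d = (coeff p d ≡ true) × (∀ j → d < j → coeff p j ≡ false)

one : Poly
one = true ∷ []

-- the variable (r, resp. t)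
X : Poly
X = false ∷ true ∷ []

X^ : ℕ → Poly
X^ n = replicate n false ++ (true ∷ [])

X+1 : Poly
X+1 = true ∷ true ∷ []

F : Poly
F = X ⊗ (X+1 ⊗ X+1 ⊗ X+1)

G : Poly
G = (X ⊗ X ⊗ X) ⊗ X+1

-- U on the basis 1, r, r^2, r^3 of ℤ/2[r] over ℤ/2[G]
U0 U1 U2 U3 : Poly
U0 = one
U1 = X
U2 = X^ 2
U3 = X^ 3 ⊕ X^ 2 ⊕ X

-- IsU f u  :  u = U(f).  U is defined via the (unique) expansion
-- f = Σ g_i(G) r^i, U(f) = Σ g_i(F) U(r^i).
IsU : Poly → Poly → Set
IsU f u = Σ Poly λ g0 → Σ Poly λ g1 → Σ Poly λ g2 → Σ Poly λ g3 →
  (f ≈ (g0 ∘ₚ G) ⊕ (g1 ∘ₚ G) ⊗ X ⊕ (g2 ∘ₚ G) ⊗ X^ 2 ⊕ (g3 ∘ₚ G) ⊗ X^ 3)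
  × (u ≈ (g0 ∘ₚ F) ⊗ U0 ⊕ (g1 ∘ₚ F) ⊗ U1 ⊕ (g2 ∘ₚ F) ⊗ U2 ⊕ (g3 ∘ₚ F) ⊗ U3)

r²+r : Poly
r²+r = X^ 2 ⊕ X

InMOdd : Poly → Set
InMOdd f = ∃ λ h → f ≈ r²+r ⊗ (h ∘ₚ X^ 2)

InK : Poly → Set
InK f = InMOdd f × IsU f f

G² : Poly
G² = G ⊗ G

monicWith : {m : ℕ} → Vec Bool m → Poly
monicWith ε = toList ε ++ (true ∷ [])

-- pr₁(f) is the class of (P(G^2))·F in K1/N1, where the N2-expansion of f is
-- f = a(G^2) G + b(G^2) F + c(G^2) F^2 G, and pr₁(f) = [b(G^2) F].
-- Two elements x,y of K1 have equal classes in K1/N1 iff x - y ∈ N1 = ℤ/2[G^2]·G.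
InN1 : Poly → Set
InN1 x = ∃ λ n → x ≈ (n ∘ₚ G²) ⊗ G

-- pr₁(f) is the class of P(G^2)·F  (P ∈ ℤ/2[t]):
-- for the expansion f = a(G^2)G + b(G^2)F + c(G^2)F^2G (unique, since
-- f ∈ K ⊆ N2 and G, F, F^2G is a basis), b(G^2)F ≡ P(G^2)F mod N1.
Pr₁Is : Poly → Poly → Set
Pr₁Is f P = ∀ a b c →
  f ≈ (a ∘ₚ G²) ⊗ G ⊕ (b ∘ₚ G²) ⊗ F ⊕ (c ∘ₚ G²) ⊗ (F ⊗ F ⊗ G) →
  InN1 ((b ∘ₚ G²) ⊗ F ⊕ (P ∘ₚ G²) ⊗ F)

{-# OPTIONS --safe #-}
-- Squaring is additive in characteristic 2, so G² = T(r²) with T = t³(t + 1), and every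
-- h ∈ ℤ/2[t] is uniquely Σ_{i<4} cᵢ(T) tⁱ.  For any expansion f = a(G²)G + b(G²)F + c(G²)F²G
-- the identity (r² + r) H(r²) = f with H = b(T) + t (a + b + t c)(T) + (t² + t³) c(T) holds;
-- cancelling r² + r and the substitution t ↦ r² gives g = H, so b is the coordinate c₀ of g.
-- As tⁱ Tᵏ has leading term t^(4k+i), deg g = 4m makes c₀ monic of degree m, and pr₁(f) is
-- the class of b(G²)F itself.
module Submission where

open import Defs
open import Data.Nat using (ℕ; zero; suc; _+_; _*_; _≤_; z≤n; s≤s)
open import Data.Nat.Properties using (m≤n⇒m≤1+n; ≤-refl; ≤-trans; *-comm; *-monoˡ-≤; m≤n+m)
open import Data.Bool using (Bool; true; false; _xor_; _∧_)
open import Data.Bool.Properties as Bool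
  using (xor-comm; xor-assoc; xor-identityʳ; xor-same; ∧-zeroʳ; ∧-comm; ∧-assoc; ∧-distribˡ-xor; ∧-distribʳ-xor)
open import Data.List using ([]; _∷_; _++_; replicate)
open import Data.List.Relation.Unary.All using ([]; _∷_; all?)
open import Data.Vec using (Vec; tabulate)
open import Data.Fin using (toℕ)
open import Data.Product using (Σ; _,_)
open import Data.Maybe using (Maybe; just; nothing)
open import Level using (0ℓ)
open import Relation.Binary using (IsEquivalence; Setoid)
import Relation.Binary.Reasoning.Setoid as SetoidReasoning
open import Relation.Binary.PropositionalEquality
open import Relation.Nullary using (¬_; Dec; yes; no)
open import Relation.Nullary.Decidable using (map′; True; toWitness)
open import Algebra.Bundles using (CommutativeRing; RawRing)
import Algebra.Properties.CommutativeSemigroup as CommutativeSemigroupProperties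
import Algebra.Solver.Ring.AlmostCommutativeRing as ACR

open CommutativeSemigroupProperties (CommutativeRing.+-commutativeSemigroup Bool.xor-∧-commutativeRing)
  using (interchange; x∙yz≈y∙xz)

xor≡false⇒≡ : ∀ x y → x xor y ≡ false → x ≡ y
xor≡false⇒≡ true  true  _ = refl
xor≡false⇒≡ false false _ = refl

≡⇒xor≡false : ∀ x y → x ≡ y → x xor y ≡ false
≡⇒xor≡false x .x refl = xor-same x

xor-false : ∀ {x y} → x ≡ false → y ≡ false → x xor y ≡ false
xor-false refl refl = refl

infix 4 _~_
record _~_ (p q : Poly) : Set where
  constructor mk~
  field at : ∀ n → coeff p n ≡ coeff q n
open _~_

~-refl : ∀ {p} → p ~ p
~-refl = mk~ λ _ → refl

~-sym : ∀ {p q} → p ~ q → q ~ p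
~-sym p~q = mk~ λ n → sym (at p~q n)

~-trans : ∀ {p q r} → p ~ q → q ~ r → p ~ r
~-trans p~q q~r = mk~ λ n → trans (at p~q n) (at q~r n)

~-isEquivalence : IsEquivalence _~_
~-isEquivalence = record { refl = ~-refl ; sym = ~-sym ; trans = ~-trans }

~-setoid : Setoid 0ℓ 0ℓ
~-setoid = record { isEquivalence = ~-isEquivalence }

∷-cong : ∀ {a p q} → p ~ q → a ∷ p ~ a ∷ q
∷-cong p~q = mk~ λ { zero → refl ; (suc n) → at p~q n }

false∷-~[] : ∀ {p} → p ~ [] → false ∷ p ~ []
false∷-~[] p~[] = mk~ λ { zero → refl ; (suc n) → at p~[] n }

coeff-⊕ : ∀ p q n → coeff (p ⊕ q) n ≡ coeff p n xor coeff q n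
coeff-⊕ []      q       n       = refl
coeff-⊕ (a ∷ p) []      n       = sym (xor-identityʳ _)
coeff-⊕ (a ∷ p) (b ∷ q) zero    = refl
coeff-⊕ (a ∷ p) (b ∷ q) (suc n) = coeff-⊕ p q n

coeff-· : ∀ c p n → coeff (c · p) n ≡ c ∧ coeff p n
coeff-· c []      n       = sym (∧-zeroʳ c)
coeff-· c (a ∷ p) zero    = refl
coeff-· c (a ∷ p) (suc n) = coeff-· c p n

coeff-∷⊗ : ∀ a p q n → coeff ((a ∷ p) ⊗ q) n ≡ (a ∧ coeff q n) xor coeff (false ∷ p ⊗ q) n
coeff-∷⊗ a p q n = trans (coeff-⊕ (a · q) (false ∷ p ⊗ q) n) (cong (_xor _) (coeff-· a q n))

IsZero⇒coeff≡false : ∀ p → IsZero p → ∀ n → coeff p n ≡ false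
IsZero⇒coeff≡false []      _          n       = refl
IsZero⇒coeff≡false (a ∷ p) (a≡0 ∷ _)  zero    = a≡0
IsZero⇒coeff≡false (a ∷ p) (_ ∷ p≡0)  (suc n) = IsZero⇒coeff≡false p p≡0 n

coeff≡false⇒IsZero : ∀ p → (∀ n → coeff p n ≡ false) → IsZero p
coeff≡false⇒IsZero []      _  = []
coeff≡false⇒IsZero (a ∷ p) p0 = p0 zero ∷ coeff≡false⇒IsZero p (λ n → p0 (suc n))

⊕~[]⇒~ : ∀ {p q} → p ⊕ q ~ [] → p ~ q
⊕~[]⇒~ {p} {q} p⊕q~[] = mk~ λ n → xor≡false⇒≡ _ _ (trans (sym (coeff-⊕ p q n)) (at p⊕q~[] n))

~⇒⊕~[] : ∀ {p q} → p ~ q → p ⊕ q ~ []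
~⇒⊕~[] {p} {q} p~q = mk~ λ n → trans (coeff-⊕ p q n) (≡⇒xor≡false _ _ (at p~q n))

≈⇒~ : ∀ {p q} → p ≈ q → p ~ q
≈⇒~ {p} {q} p≈q = ⊕~[]⇒~ (mk~ (IsZero⇒coeff≡false (p ⊕ q) p≈q))

~⇒≈ : ∀ {p q} → p ~ q → p ≈ q
~⇒≈ {p} {q} p~q = coeff≡false⇒IsZero (p ⊕ q) (at (~⇒⊕~[] p~q))

-- ℤ/2[t] as a commutative ring

⊕-cong : ∀ {p p′ q q′} → p ~ p′ → q ~ q′ → p ⊕ q ~ p′ ⊕ q′
⊕-cong {p} {p′} {q} {q′} p~p′ q~q′ = mk~ λ n → begin
  coeff (p ⊕ q) n            ≡⟨ coeff-⊕ p q n ⟩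
  coeff p n xor coeff q n    ≡⟨ cong₂ _xor_ (at p~p′ n) (at q~q′ n) ⟩
  coeff p′ n xor coeff q′ n  ≡⟨ coeff-⊕ p′ q′ n ⟨
  coeff (p′ ⊕ q′) n          ∎
  where open ≡-Reasoning

⊕-comm : ∀ p q → p ⊕ q ~ q ⊕ p
⊕-comm p q = mk~ λ n → begin
  coeff (p ⊕ q) n          ≡⟨ coeff-⊕ p q n ⟩
  coeff p n xor coeff q n  ≡⟨ xor-comm (coeff p n) _ ⟩
  coeff q n xor coeff p n  ≡⟨ coeff-⊕ q p n ⟨
  coeff (q ⊕ p) n          ∎
  where open ≡-Reasoning

⊕-assoc : ∀ p q r → (p ⊕ q) ⊕ r ~ p ⊕ (q ⊕ r)
⊕-assoc p q r = mk~ λ n → begin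
  coeff ((p ⊕ q) ⊕ r) n                        ≡⟨ coeff-⊕ (p ⊕ q) r n ⟩
  coeff (p ⊕ q) n xor coeff r n                ≡⟨ cong (_xor coeff r n) (coeff-⊕ p q n) ⟩
  (coeff p n xor coeff q n) xor coeff r n      ≡⟨ xor-assoc (coeff p n) _ _ ⟩
  coeff p n xor (coeff q n xor coeff r n)      ≡⟨ cong (coeff p n xor_) (coeff-⊕ q r n) ⟨
  coeff p n xor coeff (q ⊕ r) n                ≡⟨ coeff-⊕ p (q ⊕ r) n ⟨
  coeff (p ⊕ (q ⊕ r)) n                        ∎
  where open ≡-Reasoning

⊕-identityʳ : ∀ p → p ⊕ [] ~ p
⊕-identityʳ p = mk~ λ n → trans (coeff-⊕ p [] n) (xor-identityʳ (coeff p n))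

⊕-self : ∀ p → p ⊕ p ~ []
⊕-self p = ~⇒⊕~[] (~-refl {p})

⊕-[]ʳ : ∀ p {z} → z ~ [] → p ⊕ z ~ p
⊕-[]ʳ p z~[] = ~-trans (⊕-cong ~-refl z~[]) (⊕-identityʳ p)

·-identityˡ : ∀ p → true · p ~ p
·-identityˡ p = mk~ (coeff-· true p)

·-zeroˡ : ∀ p → false · p ~ []
·-zeroˡ p = mk~ (coeff-· false p)

[a]⊗ : ∀ a p → (a ∷ []) ⊗ p ~ a · p
[a]⊗ a p = ⊕-[]ʳ (a · p) (false∷-~[] ~-refl)

false∷-⊗ : ∀ p q → (false ∷ p) ⊗ q ~ false ∷ p ⊗ q
false∷-⊗ p q = mk~ (coeff-∷⊗ false p q)

⊗-zeroʳ : ∀ p → p ⊗ [] ~ []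
⊗-zeroʳ []      = ~-refl
⊗-zeroʳ (a ∷ p) = false∷-~[] (⊗-zeroʳ p)

⊗-zeroˡ : ∀ p q → p ~ [] → p ⊗ q ~ []
⊗-zeroˡ []      q _    = ~-refl
⊗-zeroˡ (a ∷ p) q p~[] with at p~[] zero
... | refl = ~-trans (false∷-⊗ p q) (false∷-~[] (⊗-zeroˡ p q (mk~ λ n → at p~[] (suc n))))

⊗-distribʳ : ∀ p q r → (p ⊕ q) ⊗ r ~ p ⊗ r ⊕ q ⊗ r
⊗-distribʳ []      q       r = ~-refl
⊗-distribʳ (a ∷ p) []      r = ~-sym (⊕-identityʳ _)
⊗-distribʳ (a ∷ p) (b ∷ q) r = mk~ λ n → begin
  coeff (((a xor b) ∷ p ⊕ q) ⊗ r) n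
    ≡⟨ coeff-∷⊗ (a xor b) (p ⊕ q) r n ⟩
  ((a xor b) ∧ coeff r n) xor coeff (false ∷ (p ⊕ q) ⊗ r) n
    ≡⟨ cong₂ _xor_ (∧-distribʳ-xor (coeff r n) a b)
                   (trans (at (∷-cong (⊗-distribʳ p q r)) n) (coeff-⊕ (false ∷ p ⊗ r) (false ∷ q ⊗ r) n)) ⟩
  ((a ∧ coeff r n) xor (b ∧ coeff r n)) xor (coeff (false ∷ p ⊗ r) n xor coeff (false ∷ q ⊗ r) n)
    ≡⟨ interchange (a ∧ coeff r n) _ _ _ ⟩
  ((a ∧ coeff r n) xor coeff (false ∷ p ⊗ r) n) xor ((b ∧ coeff r n) xor coeff (false ∷ q ⊗ r) n)
    ≡⟨ cong₂ _xor_ (coeff-∷⊗ a p r n) (coeff-∷⊗ b q r n) ⟨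
  coeff ((a ∷ p) ⊗ r) n xor coeff ((b ∷ q) ⊗ r) n
    ≡⟨ coeff-⊕ ((a ∷ p) ⊗ r) ((b ∷ q) ⊗ r) n ⟨
  coeff ((a ∷ p) ⊗ r ⊕ (b ∷ q) ⊗ r) n
    ∎
  where open ≡-Reasoning

⊗-congˡ : ∀ {p p′} q → p ~ p′ → p ⊗ q ~ p′ ⊗ q
⊗-congˡ {p} {p′} q p~p′ =
  ⊕~[]⇒~ (~-trans (~-sym (⊗-distribʳ p p′ q)) (⊗-zeroˡ (p ⊕ p′) q (~⇒⊕~[] p~p′)))

⊗-∷ʳ : ∀ p b q → p ⊗ (b ∷ q) ~ b · p ⊕ (false ∷ p ⊗ q)
⊗-∷ʳ []      b q = ~-sym (false∷-~[] ~-refl)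
⊗-∷ʳ (a ∷ p) b q = mk~ λ
  { zero    → cong (_xor false) (∧-comm a b)
  ; (suc m) → begin
      coeff ((a ∷ p) ⊗ (b ∷ q)) (suc m)
        ≡⟨ coeff-∷⊗ a p (b ∷ q) (suc m) ⟩
      (a ∧ coeff q m) xor coeff (p ⊗ (b ∷ q)) m
        ≡⟨ cong ((a ∧ coeff q m) xor_) (trans (at (⊗-∷ʳ p b q) m)
             (trans (coeff-⊕ (b · p) (false ∷ p ⊗ q) m) (cong (_xor _) (coeff-· b p m)))) ⟩
      (a ∧ coeff q m) xor ((b ∧ coeff p m) xor coeff (false ∷ p ⊗ q) m)
        ≡⟨ x∙yz≈y∙xz (a ∧ coeff q m) (b ∧ coeff p m) _ ⟩
      (b ∧ coeff p m) xor ((a ∧ coeff q m) xor coeff (false ∷ p ⊗ q) m)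
        ≡⟨ cong ((b ∧ coeff p m) xor_) (coeff-∷⊗ a p q m) ⟨
      (b ∧ coeff p m) xor coeff ((a ∷ p) ⊗ q) m
        ≡⟨ trans (coeff-⊕ (b · (a ∷ p)) (false ∷ (a ∷ p) ⊗ q) (suc m)) (cong (_xor _) (coeff-· b p m)) ⟨
      coeff (b · (a ∷ p) ⊕ (false ∷ (a ∷ p) ⊗ q)) (suc m)
        ∎ }
  where open ≡-Reasoning

⊗-comm : ∀ p q → p ⊗ q ~ q ⊗ p
⊗-comm []      q = ~-sym (⊗-zeroʳ q)
⊗-comm (a ∷ p) q = ~-trans (⊕-cong ~-refl (∷-cong (⊗-comm p q))) (~-sym (⊗-∷ʳ q a p))

⊗-congʳ : ∀ p {q q′} → q ~ q′ → p ⊗ q ~ p ⊗ q′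
⊗-congʳ p {q} {q′} q~q′ = ~-trans (⊗-comm p q) (~-trans (⊗-congˡ p q~q′) (⊗-comm q′ p))

⊗-cong : ∀ {p p′ q q′} → p ~ p′ → q ~ q′ → p ⊗ q ~ p′ ⊗ q′
⊗-cong {p′ = p′} {q = q} p~p′ q~q′ = ~-trans (⊗-congˡ q p~p′) (⊗-congʳ p′ q~q′)

⊗-distribˡ : ∀ p q r → p ⊗ (q ⊕ r) ~ p ⊗ q ⊕ p ⊗ r
⊗-distribˡ p q r =
  ~-trans (⊗-comm p (q ⊕ r)) (~-trans (⊗-distribʳ q r p) (⊕-cong (⊗-comm q p) (⊗-comm r p)))

·-⊗-assoc : ∀ c q r → (c · q) ⊗ r ~ c · (q ⊗ r)
·-⊗-assoc c []      r = ~-refl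
·-⊗-assoc c (a ∷ q) r = mk~ λ n → begin
  coeff (((c ∧ a) ∷ c · q) ⊗ r) n
    ≡⟨ coeff-∷⊗ (c ∧ a) (c · q) r n ⟩
  ((c ∧ a) ∧ coeff r n) xor coeff (false ∷ (c · q) ⊗ r) n
    ≡⟨ cong₂ _xor_ (∧-assoc c a (coeff r n)) (at (∷-cong (·-⊗-assoc c q r)) n) ⟩
  (c ∧ (a ∧ coeff r n)) xor coeff (false ∷ c · (q ⊗ r)) n
    ≡⟨ cong ((c ∧ (a ∧ coeff r n)) xor_) (coeff-false∷-· (q ⊗ r) n) ⟩
  (c ∧ (a ∧ coeff r n)) xor (c ∧ coeff (false ∷ q ⊗ r) n)
    ≡⟨ ∧-distribˡ-xor c (a ∧ coeff r n) _ ⟨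
  c ∧ ((a ∧ coeff r n) xor coeff (false ∷ q ⊗ r) n)
    ≡⟨ cong (c ∧_) (coeff-∷⊗ a q r n) ⟨
  c ∧ coeff ((a ∷ q) ⊗ r) n
    ≡⟨ coeff-· c ((a ∷ q) ⊗ r) n ⟨
  coeff (c · ((a ∷ q) ⊗ r)) n
    ∎
  where
  open ≡-Reasoning
  coeff-false∷-· : ∀ p n → coeff (false ∷ c · p) n ≡ c ∧ coeff (false ∷ p) n
  coeff-false∷-· p zero    = sym (∧-zeroʳ c)
  coeff-false∷-· p (suc n) = coeff-· c p n

⊗-assoc : ∀ p q r → (p ⊗ q) ⊗ r ~ p ⊗ (q ⊗ r)
⊗-assoc []      q r = ~-refl
⊗-assoc (a ∷ p) q r = ~-trans (⊗-distribʳ (a · q) (false ∷ p ⊗ q) r)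
  (⊕-cong (·-⊗-assoc a q r) (~-trans (false∷-⊗ (p ⊗ q) r) (∷-cong (⊗-assoc p q r))))

⊗-identityˡ : ∀ p → one ⊗ p ~ p
⊗-identityˡ p = ~-trans ([a]⊗ true p) (·-identityˡ p)

⊕-⊗-commutativeRing : CommutativeRing 0ℓ 0ℓ
⊕-⊗-commutativeRing = record
  { Carrier = Poly ; _≈_ = _~_ ; _+_ = _⊕_ ; _*_ = _⊗_ ; -_ = λ p → p ; 0# = [] ; 1# = one
  ; isCommutativeRing = record
    { isRing = record
      { +-isAbelianGroup = record
        { isGroup = record
          { isMonoid = record
            { isSemigroup = record
              { isMagma = record { isEquivalence = ~-isEquivalence ; ∙-cong = ⊕-cong }
              ; assoc = ⊕-assoc }
            ; identity = (λ _ → ~-refl) , ⊕-identityʳ }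
          ; inverse = ⊕-self , ⊕-self
          ; ⁻¹-cong = λ p~q → p~q }
        ; comm = ⊕-comm }
      ; *-cong = ⊗-cong ; *-assoc = ⊗-assoc
      ; *-identity = ⊗-identityˡ , (λ p → ~-trans (⊗-comm p one) (⊗-identityˡ p))
      ; distrib = ⊗-distribˡ , (λ p q r → ⊗-distribʳ q r p) }
    ; *-comm = ⊗-comm } }

xor-∧-rawRing : RawRing 0ℓ 0ℓ
xor-∧-rawRing = CommutativeRing.rawRing Bool.xor-∧-commutativeRing

constant-homomorphism :
  xor-∧-rawRing ACR.-Raw-AlmostCommutative⟶ ACR.fromCommutativeRing ⊕-⊗-commutativeRing
constant-homomorphism = record
  { ⟦_⟧ = λ c → c ∷ []
  ; +-homo = λ _ _ → ~-refl
  ; *-homo = λ x y → ~-sym (~-trans ([a]⊗ x (y ∷ [])) (⊕-identityʳ _))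
  ; -‿homo = λ _ → ~-refl
  ; 0-homo = false∷-~[] ~-refl
  ; 1-homo = ~-refl }

constant-≟ : (x y : Bool) → Maybe (x ∷ [] ~ y ∷ [])
constant-≟ x y with x Bool.≟ y
... | yes refl = just ~-refl
... | no _     = nothing

open import Algebra.Solver.Ring xor-∧-rawRing (ACR.fromCommutativeRing ⊕-⊗-commutativeRing)
                                constant-homomorphism constant-≟
  using (solve; _:+_; _:*_; _:=_; con)

_~?_ : (p q : Poly) → Dec (p ~ q)
p ~? q = map′ ≈⇒~ ~⇒≈ (all? (λ b → b Bool.≟ false) (p ⊕ q))

by-computation : ∀ p q → {True (p ~? q)} → p ~ q
by-computation p q {p~q} = toWitness p~q

⊕-interchange : ∀ p q r s → (p ⊕ q) ⊕ (r ⊕ s) ~ (p ⊕ r) ⊕ (q ⊕ s)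
⊕-interchange = solve 4 (λ p q r s → (p :+ q) :+ (r :+ s) := (p :+ r) :+ (q :+ s)) ~-refl

[false]⊕ : ∀ p → (false ∷ []) ⊕ p ~ p
[false]⊕ p = ~-trans (⊕-comm (false ∷ []) p) (⊕-[]ʳ p (false∷-~[] ~-refl))

∘ₚ-zeroˡ : ∀ p r → p ~ [] → p ∘ₚ r ~ []
∘ₚ-zeroˡ []      r _ = ~-refl
∘ₚ-zeroˡ (a ∷ p) r p~[] with at p~[] zero
... | refl = ~-trans ([false]⊕ (r ⊗ (p ∘ₚ r)))
               (~-trans (⊗-congʳ r (∘ₚ-zeroˡ p r (mk~ λ n → at p~[] (suc n)))) (⊗-zeroʳ r))

∘ₚ-distrib-⊕ : ∀ p q r → (p ⊕ q) ∘ₚ r ~ p ∘ₚ r ⊕ q ∘ₚ r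
∘ₚ-distrib-⊕ []      q       r = ~-refl
∘ₚ-distrib-⊕ (a ∷ p) []      r = ~-sym (⊕-identityʳ _)
∘ₚ-distrib-⊕ (a ∷ p) (b ∷ q) r =
  ~-trans (⊕-cong ~-refl (⊗-congʳ r (∘ₚ-distrib-⊕ p q r)))
    (solve 5 (λ A B r P Q → (A :+ B) :+ r :* (P :+ Q) := (A :+ r :* P) :+ (B :+ r :* Q)) ~-refl
       (a ∷ []) (b ∷ []) r (p ∘ₚ r) (q ∘ₚ r))

∘ₚ-congˡ : ∀ {p p′} r → p ~ p′ → p ∘ₚ r ~ p′ ∘ₚ r
∘ₚ-congˡ {p} {p′} r p~p′ =
  ⊕~[]⇒~ (~-trans (~-sym (∘ₚ-distrib-⊕ p p′ r)) (∘ₚ-zeroˡ (p ⊕ p′) r (~⇒⊕~[] p~p′)))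

∘ₚ-congʳ : ∀ p {r r′} → r ~ r′ → p ∘ₚ r ~ p ∘ₚ r′
∘ₚ-congʳ []      r~r′ = ~-refl
∘ₚ-congʳ (a ∷ p) r~r′ = ⊕-cong ~-refl (⊗-cong r~r′ (∘ₚ-congʳ p r~r′))

·-∘ₚ : ∀ a q r → (a · q) ∘ₚ r ~ a · (q ∘ₚ r)
·-∘ₚ true  q r = ~-trans (∘ₚ-congˡ r (·-identityˡ q)) (~-sym (·-identityˡ _))
·-∘ₚ false q r = ~-trans (∘ₚ-zeroˡ (false · q) r (·-zeroˡ q)) (~-sym (·-zeroˡ _))

∘ₚ-distrib-⊗ : ∀ p q r → (p ⊗ q) ∘ₚ r ~ (p ∘ₚ r) ⊗ (q ∘ₚ r)
∘ₚ-distrib-⊗ []      q r = ~-refl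
∘ₚ-distrib-⊗ (a ∷ p) q r =
  ~-trans (∘ₚ-distrib-⊕ (a · q) (false ∷ p ⊗ q) r)
  (~-trans (⊕-cong (~-trans (·-∘ₚ a q r) (~-sym ([a]⊗ a (q ∘ₚ r))))
                   (~-trans ([false]⊕ _) (⊗-congʳ r (∘ₚ-distrib-⊗ p q r))))
   (solve 4 (λ A r P Q → A :* Q :+ r :* (P :* Q) := (A :+ r :* P) :* Q) ~-refl
      (a ∷ []) r (p ∘ₚ r) (q ∘ₚ r)))

∘ₚ-assoc : ∀ p q r → (p ∘ₚ q) ∘ₚ r ~ p ∘ₚ (q ∘ₚ r)
∘ₚ-assoc []      q r = ~-refl
∘ₚ-assoc (a ∷ p) q r =
  ~-trans (∘ₚ-distrib-⊕ (a ∷ []) (q ⊗ (p ∘ₚ q)) r)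
  (⊕-cong (⊕-[]ʳ (a ∷ []) (⊗-zeroʳ r))
          (~-trans (∘ₚ-distrib-⊗ q (p ∘ₚ q) r) (⊗-congʳ (q ∘ₚ r) (∘ₚ-assoc p q r))))

-- Cancellation of r² + r and of t ↦ r²

X^-⊗ : ∀ k y → X^ k ⊗ y ~ replicate k false ++ y
X^-⊗ zero    y = ⊗-identityˡ y
X^-⊗ (suc k) y = ~-trans (false∷-⊗ (X^ k) y) (∷-cong (X^-⊗ k y))

r²+r-⊗-cancel : ∀ y → r²+r ⊗ y ~ [] → y ~ []
r²+r-⊗-cancel y r²+r⊗y~[] = mk~ y-vanishes
  where
  r²+r-⊗ : r²+r ⊗ y ~ false ∷ y ⊕ (false ∷ y)
  r²+r-⊗ = ~-trans (false∷-⊗ (true ∷ true ∷ []) y)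
                   (∷-cong (⊕-cong (·-identityˡ y) (∷-cong (⊗-identityˡ y))))
  y⊕ty-vanishes : ∀ n → coeff y n xor coeff (false ∷ y) n ≡ false
  y⊕ty-vanishes n =
    trans (sym (coeff-⊕ y (false ∷ y) n)) (trans (sym (at r²+r-⊗ (suc n))) (at r²+r⊗y~[] (suc n)))
  y-vanishes : ∀ n → coeff y n ≡ coeff [] n
  y-vanishes zero    = trans (sym (xor-identityʳ _)) (y⊕ty-vanishes zero)
  y-vanishes (suc n) =
    trans (sym (xor-identityʳ _))
          (trans (cong (coeff y (suc n) xor_) (sym (y-vanishes n))) (y⊕ty-vanishes (suc n)))

∘ₚ-X^2-cancel : ∀ p → p ∘ₚ X^ 2 ~ [] → p ~ []
∘ₚ-X^2-cancel []      _        = ~-refl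
∘ₚ-X^2-cancel (a ∷ p) p∘X²~[] = mk~ λ
  { zero    → at expanded~[] zero
  ; (suc n) → at (∘ₚ-X^2-cancel p (mk~ λ n → at expanded~[] (suc (suc n)))) n }
  where
  expand : (a ∷ p) ∘ₚ X^ 2 ~ a ∷ false ∷ p ∘ₚ X^ 2
  expand = ~-trans (⊕-cong (~-refl {a ∷ []}) (X^-⊗ 2 (p ∘ₚ X^ 2)))
                   (mk~ λ { zero → xor-identityʳ a ; (suc n) → refl })
  expanded~[] : a ∷ false ∷ p ∘ₚ X^ 2 ~ []
  expanded~[] = ~-trans (~-sym expand) p∘X²~[]

r²+r-⊗-∘ₚX^2-injective : ∀ p q → r²+r ⊗ (p ∘ₚ X^ 2) ~ r²+r ⊗ (q ∘ₚ X^ 2) → p ~ q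
r²+r-⊗-∘ₚX^2-injective p q images~ =
  ⊕~[]⇒~ (∘ₚ-X^2-cancel (p ⊕ q) (r²+r-⊗-cancel _ difference~[]))
  where
  difference~[] : r²+r ⊗ ((p ⊕ q) ∘ₚ X^ 2) ~ []
  difference~[] = ~-trans (⊗-congʳ r²+r (∘ₚ-distrib-⊕ p q (X^ 2)))
                          (~-trans (⊗-distribˡ r²+r (p ∘ₚ X^ 2) (q ∘ₚ X^ 2)) (~⇒⊕~[] images~))

-- Coordinates over ℤ/2[T]

-- T = t³(t + 1), so that T(r²) = G².
T : Poly
T = false ∷ false ∷ false ∷ true ∷ true ∷ []

infix 4 _≋_
infixl 6 _⊞_

record Components : Set where
  constructor ⟨_,_,_,_⟩
  field c₀ c₁ c₂ c₃ : Poly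
open Components

-- The coordinates (c₀, …, c₃) of h = Σ cᵢ(T) tⁱ, by Horner's rule: since t⁴ = T + t³,
-- t · (c₀ + c₁ t + c₂ t² + c₃ t³) = T c₃ + c₀ t + c₁ t² + (c₂ + c₃) t³.
components : Poly → Components
components []      = ⟨ [] , [] , [] , [] ⟩
components (a ∷ h) = ⟨ a ∷ c₃ hᶜ , c₀ hᶜ , c₁ hᶜ , c₂ hᶜ ⊕ c₃ hᶜ ⟩
  where hᶜ = components h

t·_ : Components → Components
t· d = ⟨ false ∷ c₃ d , c₀ d , c₁ d , c₂ d ⊕ c₃ d ⟩

t^ : ℕ → Components → Components
t^ zero    d = d
t^ (suc k) d = t· t^ k d

_⊞_ : Components → Components → Components
d ⊞ e = ⟨ c₀ d ⊕ c₀ e , c₁ d ⊕ c₁ e , c₂ d ⊕ c₂ e , c₃ d ⊕ c₃ e ⟩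

record _≋_ (d e : Components) : Set where
  constructor mk≋
  field ≋c₀ : c₀ d ~ c₀ e
        ≋c₁ : c₁ d ~ c₁ e
        ≋c₂ : c₂ d ~ c₂ e
        ≋c₃ : c₃ d ~ c₃ e
open _≋_

≋-refl : ∀ {d} → d ≋ d
≋-refl = mk≋ ~-refl ~-refl ~-refl ~-refl

≋-sym : ∀ {d e} → d ≋ e → e ≋ d
≋-sym d≋e = mk≋ (~-sym (≋c₀ d≋e)) (~-sym (≋c₁ d≋e)) (~-sym (≋c₂ d≋e)) (~-sym (≋c₃ d≋e))

≋-trans : ∀ {d e f} → d ≋ e → e ≋ f → d ≋ f
≋-trans d≋e e≋f = mk≋ (~-trans (≋c₀ d≋e) (≋c₀ e≋f)) (~-trans (≋c₁ d≋e) (≋c₁ e≋f))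
                      (~-trans (≋c₂ d≋e) (≋c₂ e≋f)) (~-trans (≋c₃ d≋e) (≋c₃ e≋f))

⊞-cong : ∀ {d d′ e e′} → d ≋ d′ → e ≋ e′ → d ⊞ e ≋ d′ ⊞ e′
⊞-cong d≋d′ e≋e′ = mk≋ (⊕-cong (≋c₀ d≋d′) (≋c₀ e≋e′)) (⊕-cong (≋c₁ d≋d′) (≋c₁ e≋e′))
                       (⊕-cong (≋c₂ d≋d′) (≋c₂ e≋e′)) (⊕-cong (≋c₃ d≋d′) (≋c₃ e≋e′))

t·-cong : ∀ {d e} → d ≋ e → t· d ≋ t· e
t·-cong d≋e = mk≋ (∷-cong (≋c₃ d≋e)) (≋c₀ d≋e) (≋c₁ d≋e) (⊕-cong (≋c₂ d≋e) (≋c₃ d≋e))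

components-zero : ∀ h → h ~ [] → components h ≋ ⟨ [] , [] , [] , [] ⟩
components-zero []      _    = ≋-refl
components-zero (a ∷ h) h~[] with at h~[] zero
... | refl = let IH = components-zero h (mk~ λ n → at h~[] (suc n)) in
  mk≋ (false∷-~[] (≋c₃ IH)) (≋c₀ IH) (≋c₁ IH) (⊕-cong (≋c₂ IH) (≋c₃ IH))

components-⊕ : ∀ p q → components (p ⊕ q) ≋ components p ⊞ components q
components-⊕ []      q       = ≋-refl
components-⊕ (a ∷ p) []      =
  ≋-sym (mk≋ (⊕-identityʳ _) (⊕-identityʳ _) (⊕-identityʳ _) (⊕-identityʳ _))
components-⊕ (a ∷ p) (b ∷ q) = let IH = components-⊕ p q in
  mk≋ (∷-cong (≋c₃ IH)) (≋c₀ IH) (≋c₁ IH)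
      (~-trans (⊕-cong (≋c₂ IH) (≋c₃ IH))
               (⊕-interchange (c₂ (components p)) (c₂ (components q))
                              (c₃ (components p)) (c₃ (components q))))

components-cong : ∀ {p q} → p ~ q → components p ≋ components q
components-cong {p} {q} p~q =
  mk≋ (⊕~[]⇒~ (≋c₀ p⊕q≋0)) (⊕~[]⇒~ (≋c₁ p⊕q≋0)) (⊕~[]⇒~ (≋c₂ p⊕q≋0)) (⊕~[]⇒~ (≋c₃ p⊕q≋0))
  where
  p⊕q≋0 : components p ⊞ components q ≋ ⟨ [] , [] , [] , [] ⟩
  p⊕q≋0 = ≋-trans (≋-sym (components-⊕ p q)) (components-zero (p ⊕ q) (~⇒⊕~[] p~q))

-- T (p ∘ T) = (t³ + t⁴)(p ∘ T), and the t³-coordinates of the two summands cancel.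
components-∘ₚT : ∀ p → components (p ∘ₚ T) ≋ ⟨ p , [] , [] , [] ⟩
components-∘ₚT []      = ≋-refl
components-∘ₚT (a ∷ p) = ≋-trans expand (mk≋
  (mk~ λ { zero → xor-identityʳ a ; (suc n) → at (⊕-identityʳ p) n })
  (false∷-~[] ~-refl)
  (false∷-~[] ~-refl)
  (~-trans (⊕-cong (⊕-identityʳ p) (⊕-cong (false∷-~[] ~-refl) (⊕-identityʳ p))) (⊕-self p)))
  where
  pᵀ : Components
  pᵀ = ⟨ p , [] , [] , [] ⟩
  T-⊗ : ∀ z → T ⊗ z ~ replicate 3 false ++ z ⊕ (false ∷ z)
  T-⊗ z = ~-trans (false∷-⊗ (false ∷ false ∷ true ∷ true ∷ []) z)
    (∷-cong (~-trans (false∷-⊗ (false ∷ true ∷ true ∷ []) z)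
    (∷-cong (~-trans (false∷-⊗ (true ∷ true ∷ []) z)
    (∷-cong (⊕-cong (·-identityˡ z) (∷-cong (⊗-identityˡ z))))))))
  expand : components ((a ∷ []) ⊕ T ⊗ (p ∘ₚ T)) ≋ components (a ∷ []) ⊞ (t^ 3 pᵀ ⊞ t^ 4 pᵀ)
  expand = ≋-trans (components-⊕ (a ∷ []) (T ⊗ (p ∘ₚ T)))
    (⊞-cong ≋-refl (≋-trans (components-cong (T-⊗ (p ∘ₚ T)))
      (≋-trans (components-⊕ (replicate 3 false ++ p ∘ₚ T) (replicate 4 false ++ p ∘ₚ T))
        (⊞-cong (t·-cong (t·-cong (t·-cong (components-∘ₚT p))))
                (t·-cong (t·-cong (t·-cong (t·-cong (components-∘ₚT p)))))))))

components-X^-⊗-∘ₚT : ∀ k p → components (X^ k ⊗ (p ∘ₚ T)) ≋ t^ k ⟨ p , [] , [] , [] ⟩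
components-X^-⊗-∘ₚT k p = ≋-trans (components-cong (X^-⊗ k (p ∘ₚ T))) (shifted k)
  where
  shifted : ∀ k → components (replicate k false ++ p ∘ₚ T) ≋ t^ k ⟨ p , [] , [] , [] ⟩
  shifted zero    = components-∘ₚT p
  shifted (suc k) = t·-cong (shifted k)

VanishesFrom : Poly → ℕ → Set
VanishesFrom h n = ∀ j → n ≤ j → coeff h j ≡ false

VanishesFrom-tail : ∀ {a h n} → VanishesFrom (a ∷ h) (suc n) → VanishesFrom h n
VanishesFrom-tail h-vanishes j n≤j = h-vanishes (suc j) (s≤s n≤j)

HasDegree-tail : ∀ {a h m} → HasDegree (a ∷ h) (suc m) → HasDegree h m
HasDegree-tail (top , above) = top , λ j m<j → above (suc j) (s≤s m<j)

record ComponentsVanishFrom (d : Components) (n : ℕ) : Set where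
  field vanish₀ : ∀ k → n ≤ k * 4 → coeff (c₀ d) k ≡ false
        vanish₁ : ∀ k → n ≤ 1 + k * 4 → coeff (c₁ d) k ≡ false
        vanish₂ : ∀ k → n ≤ 2 + k * 4 → coeff (c₂ d) k ≡ false
        vanish₃ : ∀ k → n ≤ 3 + k * 4 → coeff (c₃ d) k ≡ false
open ComponentsVanishFrom

record LeadingCoefficients (h : Poly) : Set where
  field lead₀ : ∀ k → VanishesFrom h (1 + k * 4) → coeff (c₀ (components h)) k ≡ coeff h (k * 4)
        lead₁ : ∀ k → VanishesFrom h (2 + k * 4) → coeff (c₁ (components h)) k ≡ coeff h (1 + k * 4)
        lead₂ : ∀ k → VanishesFrom h (3 + k * 4) → coeff (c₂ (components h)) k ≡ coeff h (2 + k * 4)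
        lead₃ : ∀ k → VanishesFrom h (4 + k * 4) → coeff (c₃ (components h)) k ≡ coeff h (3 + k * 4)
open LeadingCoefficients

components-vanish : ∀ h n → VanishesFrom h n → ComponentsVanishFrom (components h) n
components-vanish h zero h-vanishes = record
  { vanish₀ = λ k _ → at (≋c₀ h≋0) k ; vanish₁ = λ k _ → at (≋c₁ h≋0) k
  ; vanish₂ = λ k _ → at (≋c₂ h≋0) k ; vanish₃ = λ k _ → at (≋c₃ h≋0) k }
  where h≋0 = components-zero h (mk~ λ j → h-vanishes j z≤n)
components-vanish []      (suc n) _ = record
  { vanish₀ = λ _ _ → refl ; vanish₁ = λ _ _ → refl ; vanish₂ = λ _ _ → refl ; vanish₃ = λ _ _ → refl }
components-vanish (a ∷ h) (suc n) h-vanishes = record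
  { vanish₀ = λ { zero () ; (suc k) (s≤s n≤) → vanish₃ IH k n≤ }
  ; vanish₁ = λ { k (s≤s n≤) → vanish₀ IH k n≤ }
  ; vanish₂ = λ { k (s≤s n≤) → vanish₁ IH k n≤ }
  ; vanish₃ = λ { k (s≤s n≤) → trans (coeff-⊕ (c₂ (components h)) (c₃ (components h)) k)
                                     (xor-false (vanish₂ IH k n≤) (vanish₃ IH k (m≤n⇒m≤1+n n≤))) } }
  where IH = components-vanish h n (VanishesFrom-tail h-vanishes)

components-leading : ∀ h → LeadingCoefficients h
components-leading []      = record
  { lead₀ = λ _ _ → refl ; lead₁ = λ _ _ → refl ; lead₂ = λ _ _ → refl ; lead₃ = λ _ _ → refl }
components-leading (a ∷ h) = record
  { lead₀ = λ { zero _ → refl ; (suc k) vanishes → lead₃ IH k (VanishesFrom-tail vanishes) }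
  ; lead₁ = λ k vanishes → lead₀ IH k (VanishesFrom-tail vanishes)
  ; lead₂ = λ k vanishes → lead₁ IH k (VanishesFrom-tail vanishes)
  ; lead₃ = λ k vanishes → let tail-vanishes = VanishesFrom-tail vanishes in
      trans (coeff-⊕ (c₂ (components h)) (c₃ (components h)) k)
            (trans (cong₂ _xor_ (lead₂ IH k tail-vanishes)
                                (vanish₃ (components-vanish h _ tail-vanishes) k ≤-refl))
                   (xor-identityʳ _)) }
  where IH = components-leading h

components-degree : ∀ h m → HasDegree h (m * 4) → HasDegree (c₀ (components h)) m
components-degree h m (top , above) =
  trans (lead₀ (components-leading h) m above) top ,
  λ k m<k → vanish₀ (components-vanish h _ above) k
                    (≤-trans (m≤n+m (suc (m * 4)) 3) (*-monoˡ-≤ 4 m<k))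

monicWith-coefficients : ∀ h m → HasDegree h m →
                         monicWith (tabulate {n = m} (λ i → coeff h (toℕ i))) ~ h
monicWith-coefficients []      m       (() , _)
monicWith-coefficients (a ∷ h) zero    (top , above) =
  mk~ λ { zero → sym top ; (suc j) → sym (above (suc j) (s≤s z≤n)) }
monicWith-coefficients (a ∷ h) (suc m) degree =
  ∷-cong (monicWith-coefficients h m (HasDegree-tail degree))

-- Expansions of (r² + r) g(r²) in G, F, F²G over ℤ/2[G²]

G-of F-of : Poly → Poly
G-of x = (x ⊗ x ⊗ x) ⊗ (x ⊕ one)
F-of x = x ⊗ ((x ⊕ one) ⊗ (x ⊕ one) ⊗ (x ⊕ one))

-- (r² + r) H(r²) = expansion (below), with a, b, c in the roles of a(G²), b(G²), c(G²).
expansion-identity : ∀ a b c x →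
  (x ⊗ x ⊕ x) ⊗ (b ⊕ (x ⊗ x) ⊗ (a ⊕ b ⊕ (G-of x ⊗ G-of x) ⊗ c)
                   ⊕ (x ⊗ x ⊗ x ⊗ x) ⊗ c ⊕ (x ⊗ x ⊗ x ⊗ x ⊗ x ⊗ x) ⊗ c)
  ~ a ⊗ G-of x ⊕ b ⊗ F-of x ⊕ c ⊗ (F-of x ⊗ F-of x ⊗ G-of x)
expansion-identity = solve 4 (λ a b c x →
  let Gₓ = (x :* x :* x) :* (x :+ con true)
      Fₓ = x :* ((x :+ con true) :* (x :+ con true) :* (x :+ con true))
  in  (x :* x :+ x) :* (b :+ (x :* x) :* (a :+ b :+ (Gₓ :* Gₓ) :* c)
        :+ (x :* x :* x :* x) :* c :+ (x :* x :* x :* x :* x :* x) :* c)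
      := a :* Gₓ :+ b :* Fₓ :+ c :* (Fₓ :* Fₓ :* Gₓ)) ~-refl

∘ₚ-distrib-⊕₄ : ∀ p q r s u → (p ⊕ q ⊕ r ⊕ s) ∘ₚ u ~ p ∘ₚ u ⊕ q ∘ₚ u ⊕ r ∘ₚ u ⊕ s ∘ₚ u
∘ₚ-distrib-⊕₄ p q r s u =
  ~-trans (∘ₚ-distrib-⊕ (p ⊕ q ⊕ r) s u)
          (⊕-cong (~-trans (∘ₚ-distrib-⊕ (p ⊕ q) r u) (⊕-cong (∘ₚ-distrib-⊕ p q u) ~-refl)) ~-refl)

components-⊕₄ : ∀ p q r s →
  components (p ⊕ q ⊕ r ⊕ s) ≋ components p ⊞ components q ⊞ components r ⊞ components s
components-⊕₄ p q r s =
  ≋-trans (components-⊕ (p ⊕ q ⊕ r) s)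
          (⊞-cong (≋-trans (components-⊕ (p ⊕ q) r) (⊞-cong (components-⊕ p q) ≋-refl)) ≋-refl)

∘ₚT-∘ₚX^2 : ∀ p → (p ∘ₚ T) ∘ₚ X^ 2 ~ p ∘ₚ G²
∘ₚT-∘ₚX^2 p = ~-trans (∘ₚ-assoc p T (X^ 2)) (∘ₚ-congʳ p (by-computation (T ∘ₚ X^ 2) G²))

X^-⊗-∘ₚT-∘ₚX^2 : ∀ k p → (X^ k ⊗ (p ∘ₚ T)) ∘ₚ X^ 2 ~ (X^ k ∘ₚ X^ 2) ⊗ (p ∘ₚ G²)
X^-⊗-∘ₚT-∘ₚX^2 k p =
  ~-trans (∘ₚ-distrib-⊗ (X^ k) (p ∘ₚ T) (X^ 2)) (⊗-congʳ (X^ k ∘ₚ X^ 2) (∘ₚT-∘ₚX^2 p))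

module Expansion (a b c : Poly) where

  expansion : Poly
  expansion = (a ∘ₚ G²) ⊗ G ⊕ (b ∘ₚ G²) ⊗ F ⊕ (c ∘ₚ G²) ⊗ (F ⊗ F ⊗ G)

  A : Poly
  A = a ⊕ b ⊕ X ⊗ c

  preimage : Poly
  preimage = b ∘ₚ T ⊕ X^ 1 ⊗ (A ∘ₚ T) ⊕ X^ 2 ⊗ (c ∘ₚ T) ⊕ X^ 3 ⊗ (c ∘ₚ T)

  a′ b′ c′ : Poly
  a′ = a ∘ₚ G²
  b′ = b ∘ₚ G²
  c′ = c ∘ₚ G²

  A∘ₚG² : A ∘ₚ G² ~ a′ ⊕ b′ ⊕ G² ⊗ c′
  A∘ₚG² = ~-trans (∘ₚ-distrib-⊕ (a ⊕ b) (X ⊗ c) G²)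
    (⊕-cong (∘ₚ-distrib-⊕ a b G²)
            (~-trans (∘ₚ-distrib-⊗ X c G²) (⊗-congˡ c′ (by-computation (X ∘ₚ G²) G²))))

  preimage-∘ₚX^2 : preimage ∘ₚ X^ 2 ~
    b′ ⊕ (X ⊗ X) ⊗ (a′ ⊕ b′ ⊕ G² ⊗ c′) ⊕ (X ⊗ X ⊗ X ⊗ X) ⊗ c′ ⊕ (X ⊗ X ⊗ X ⊗ X ⊗ X ⊗ X) ⊗ c′
  preimage-∘ₚX^2 = begin
    preimage ∘ₚ X^ 2
      ≈⟨ ∘ₚ-distrib-⊕₄ (b ∘ₚ T) (X^ 1 ⊗ (A ∘ₚ T)) (X^ 2 ⊗ (c ∘ₚ T)) (X^ 3 ⊗ (c ∘ₚ T)) (X^ 2) ⟩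
    (b ∘ₚ T) ∘ₚ X^ 2 ⊕ (X^ 1 ⊗ (A ∘ₚ T)) ∘ₚ X^ 2
      ⊕ (X^ 2 ⊗ (c ∘ₚ T)) ∘ₚ X^ 2 ⊕ (X^ 3 ⊗ (c ∘ₚ T)) ∘ₚ X^ 2
      ≈⟨ ⊕-cong (⊕-cong (⊕-cong (∘ₚT-∘ₚX^2 b) (X^-⊗-∘ₚT-∘ₚX^2 1 A)) (X^-⊗-∘ₚT-∘ₚX^2 2 c))
                (X^-⊗-∘ₚT-∘ₚX^2 3 c) ⟩
    b′ ⊕ (X^ 1 ∘ₚ X^ 2) ⊗ (A ∘ₚ G²) ⊕ (X^ 2 ∘ₚ X^ 2) ⊗ c′ ⊕ (X^ 3 ∘ₚ X^ 2) ⊗ c′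
      ≈⟨ ⊕-cong (⊕-cong (⊕-cong (~-refl {b′})
                                (⊗-cong (by-computation (X^ 1 ∘ₚ X^ 2) (X ⊗ X)) A∘ₚG²))
                        (⊗-congˡ c′ (by-computation (X^ 2 ∘ₚ X^ 2) (X ⊗ X ⊗ X ⊗ X))))
                (⊗-congˡ c′ (by-computation (X^ 3 ∘ₚ X^ 2) (X ⊗ X ⊗ X ⊗ X ⊗ X ⊗ X))) ⟩
    b′ ⊕ (X ⊗ X) ⊗ (a′ ⊕ b′ ⊕ G² ⊗ c′) ⊕ (X ⊗ X ⊗ X ⊗ X) ⊗ c′ ⊕ (X ⊗ X ⊗ X ⊗ X ⊗ X ⊗ X) ⊗ c′
      ∎
    where open SetoidReasoning ~-setoid

  r²+r-⊗-preimage : r²+r ⊗ (preimage ∘ₚ X^ 2) ~ expansion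
  r²+r-⊗-preimage =
    ~-trans (⊗-cong (by-computation r²+r (X ⊗ X ⊕ X)) preimage-∘ₚX^2) (expansion-identity a′ b′ c′ X)

  c₀-preimage : c₀ (components preimage) ~ b
  c₀-preimage = begin
    c₀ (components preimage)
      ≈⟨ ≋c₀ (≋-trans (components-⊕₄ (b ∘ₚ T) (X^ 1 ⊗ (A ∘ₚ T)) (X^ 2 ⊗ (c ∘ₚ T)) (X^ 3 ⊗ (c ∘ₚ T)))
                      (⊞-cong (⊞-cong (⊞-cong (components-∘ₚT b) (components-X^-⊗-∘ₚT 1 A))
                                      (components-X^-⊗-∘ₚT 2 c))
                              (components-X^-⊗-∘ₚT 3 c))) ⟩
    c₀ (⟨ b , [] , [] , [] ⟩ ⊞ t^ 1 ⟨ A , [] , [] , [] ⟩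
        ⊞ t^ 2 ⟨ c , [] , [] , [] ⟩ ⊞ t^ 3 ⟨ c , [] , [] , [] ⟩)
      ≈⟨ ~-trans (⊕-[]ʳ _ 0~[]) (~-trans (⊕-[]ʳ _ 0~[]) (⊕-[]ʳ b 0~[])) ⟩
    b ∎
    where
    open SetoidReasoning ~-setoid
    0~[] : false ∷ [] ~ []
    0~[] = false∷-~[] ~-refl

  c₀-components : ∀ g → r²+r ⊗ (g ∘ₚ X^ 2) ~ expansion → c₀ (components g) ~ b
  c₀-components g g-expands = ~-trans (≋c₀ (components-cong g~preimage)) c₀-preimage
    where
    g~preimage : g ~ preimage
    g~preimage = r²+r-⊗-∘ₚX^2-injective g preimage (~-trans g-expands (~-sym r²+r-⊗-preimage))

lemma3p4 : (f : Poly) → InK f → ¬ IsZero f →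
           (g : Poly) → f ≈ r²+r ⊗ (g ∘ₚ X^ 2) →
           (m : ℕ) → HasDegree g (4 * m) →
           Σ (Vec Bool m) λ ε → Pr₁Is f (monicWith ε)
lemma3p4 f _ _ g f≈ m degree = ε , pr₁f
  where
  P : Poly
  P = c₀ (components g)
  ε : Vec Bool m
  ε = tabulate (λ i → coeff P (toℕ i))
  monicWith-ε : monicWith ε ~ P
  monicWith-ε =
    monicWith-coefficients P m (components-degree g m (subst (HasDegree g) (*-comm 4 m) degree))
  pr₁f : Pr₁Is f (monicWith ε)
  pr₁f a b c f≈expansion = [] , ~⇒≈ (~⇒⊕~[] (⊗-congˡ F (∘ₚ-congˡ G² b~monicWith-ε)))
    where
    open Expansion a b c
    g-expands : r²+r ⊗ (g ∘ₚ X^ 2) ~ expansion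
    g-expands = ~-trans (~-sym (≈⇒~ {f} f≈)) (≈⇒~ {f} f≈expansion)
    b~monicWith-ε : b ~ monicWith ε
    b~monicWith-ε = ~-trans (~-sym (c₀-components g g-expands)) (~-sym monicWith-ε)
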